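{- Let $P,Q,R$ be unary predicate symbols and $S$ a $0$-ary predicate symbol (propositional variable), and let $$\Gamma = \forall x\, \exists y\, (Py \wedge (Qy \rightarrow Rx)) \wedge \neg \forall x\, Rx,\qquad \Delta = \forall x\,(Px \rightarrow (Qx \vee S)) \rightarrow S.$$ Then the implication $\Gamma\rightarrow\Delta$ is valid in all Grzegorczyk-models (i.e. forced at every state of every G-model).
   Context: The language uses connectives $\wedge,\vee,\rightarrow,\perp$ and quantifiers $\forall,\exists$, with $\neg A := A\rightarrow\perp$. A Grzegorczyk-model (G-model) is a structure $\mathcal{M}=\langle W,\leq,\mathbf{w},D,\phi\rangle$ where $W$ is a non-empty set, $\leq$ is a reflexive transitive relation on $W$, $\mathbf{w}\in W$ satisfies $\mathbf{w}\leq v$ for all $v\in W$, $D$ is a non-empty set, and for each $k$-ary predicate symbol $P$, $\phi(P)\subseteq W\times D^k$ satisfies: if $v\leq w$ and $\langle v,a_1,\dots,a_k\rangle\in\phi(P)$ then $\langle w,a_1,\dots,a_k\rangle\in\phi(P)$. Forcing: $v\Vdash P a_1\dots a_k$ iff $\langle v,a_1,\dots,a_k\rangle\in\phi(P)$; $\wedge,\vee$ evaluated locally; $v\Vdash A\rightarrow B$ iff for all $w\geq v$, $w\Vdash A$ implies $w\Vdash B$; $v\Vdash\perp$ never; $v\Vdash\exists x A$ iff $v\Vdash A[a/x]$ for some $a\in D$; $v\Vdash\forall x A$ iff $v\Vdash A[a/x]$ for all $a\in D$. -}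

module Defs where

open import Data.Bool using (Bool; true)
open import Data.Empty using (⊥)
open import Data.Product using (_×_; Σ)
open import Data.Sum using (_⊎_)
open import Relation.Binary.PropositionalEquality using (_≡_)

-- A Grzegorczyk-model for the signature {P, Q, R unary; S 0-ary}.
-- φ(P) ⊆ W × D is given by its characteristic function W → D → Bool
-- (classical subsets), and upward persistence is required.
record GModel : Set₁ where
  field
    W      : Set
    _≤_    : W → W → Set
    ≤-refl  : ∀ {v} → v ≤ v
    ≤-trans : ∀ {u v w} → u ≤ v → v ≤ w → u ≤ w
    root   : W
    root≤  : ∀ v → root ≤ v
    D      : Set
    d₀     : D
    φP φQ φR : W → D → Bool
    φS     : W → Bool
    monoP  : ∀ {v w a} → v ≤ w → φP v a ≡ true → φP w a ≡ true
    monoQ  : ∀ {v w a} → v ≤ w → φQ v a ≡ true → φQ w a ≡ true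
    monoR  : ∀ {v w a} → v ≤ w → φR v a ≡ true → φR w a ≡ true
    monoS  : ∀ {v w} → v ≤ w → φS v ≡ true → φS w ≡ true

-- Formulas (closed, with parameters from D) are interpreted by their
-- forcing relation: a predicate on states.  The combinators below are
-- exactly the forcing clauses of G-models.
module Forcing (M : GModel) where
  open GModel M

  Form : Set₁
  Form = W → Set

  P̂ Q̂ R̂ : D → Form
  P̂ a v = φP v a ≡ true
  Q̂ a v = φQ v a ≡ true
  R̂ a v = φR v a ≡ true

  Ŝ : Form
  Ŝ v = φS v ≡ true

  ⊥̂ : Form
  ⊥̂ v = ⊥

  infixr 6 _∧̂_
  infixr 5 _∨̂_
  infixr 4 _⇒_

  _∧̂_ _∨̂_ _⇒_ : Form → Form → Form
  (A ∧̂ B) v = A v × B v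
  (A ∨̂ B) v = A v ⊎ B v
  (A ⇒ B) v = ∀ w → v ≤ w → A w → B w

  ¬̂_ : Form → Form
  ¬̂ A = A ⇒ ⊥̂

  ∀̂ ∃̂ : (D → Form) → Form
  ∀̂ A v = ∀ a → A a v
  ∃̂ A v = Σ D λ a → A a v

  Γ : Form
  Γ = ∀̂ (λ x → ∃̂ (λ y → P̂ y ∧̂ (Q̂ y ⇒ R̂ x))) ∧̂ ¬̂ ∀̂ (λ x → R̂ x)

  Δ : Form
  Δ = ∀̂ (λ x → P̂ x ⇒ (Q̂ x ∨̂ Ŝ)) ⇒ Ŝ

{-# OPTIONS --safe #-}
-- At a state u above w where ∀x (Px → Qx ∨ S) holds, S is either forced at u
-- or not.  If not, every x has a witness y with Py (persistent from w to u),
-- so Qy ∨ S at u gives Qy, and Qy → Rx yields Rx: thus ∀x Rx is forced at u,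
-- contradicting ¬ ∀x Rx.  The case split on S is where the classical
-- (two-valued) atomic valuation is used.
module Submission where

open import Defs
open import Data.Bool using (true; _≟_)
open import Data.Product using (_,_)
open import Data.Sum using (inj₁; inj₂)
open import Data.Empty using (⊥-elim)
open import Relation.Nullary using (¬_; yes; no)

module _ (M : GModel) where
  open GModel M
  open Forcing M

  ∀∃-persistent : ∀ {v w} → v ≤ w →
                  ∀̂ (λ x → ∃̂ (λ y → P̂ y ∧̂ (Q̂ y ⇒ R̂ x))) v →
                  ∀̂ (λ x → ∃̂ (λ y → P̂ y ∧̂ (Q̂ y ⇒ R̂ x))) w
  ∀∃-persistent v≤w h x with h x
  ... | y , py , qy⇒rx = y , monoP v≤w py , λ u w≤u → qy⇒rx u (≤-trans v≤w w≤u)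

  ∀R-unless-S : ∀ {u} →
                ∀̂ (λ x → ∃̂ (λ y → P̂ y ∧̂ (Q̂ y ⇒ R̂ x))) u →
                ∀̂ (λ x → P̂ x ⇒ (Q̂ x ∨̂ Ŝ)) u →
                ¬ Ŝ u →
                ∀̂ R̂ u
  ∀R-unless-S {u} h p⇒q∨s ¬s x with h x
  ... | y , py , qy⇒rx with p⇒q∨s y u ≤-refl py
  ...   | inj₁ qy = qy⇒rx u ≤-refl qy
  ...   | inj₂ s  = ⊥-elim (¬s s)

lemma3p1 : (M : GModel) → (v : GModel.W M) → Forcing._⇒_ M (Forcing.Γ M) (Forcing.Δ M) v
lemma3p1 M v w v≤w (h , ¬∀R) u w≤u p⇒q∨s with GModel.φS M u ≟ true
... | yes s = s
... | no ¬s = ⊥-elim (¬∀R u w≤u (∀R-unless-S M (∀∃-persistent M w≤u h) p⇒q∨s ¬s))
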